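{- Let $q$ be an odd prime power, $\beta\in\mathbb{F}_q^*$, and let $\theta_1,\theta_2\in\mathbb{F}_{q^2}$ form an $\mathbb{F}_q$-basis of $\mathbb{F}_{q^2}$ with $\mathrm{Tr}(\theta_1)=\beta$, $\mathrm{Tr}(\theta_2)=0$. Let $q_2'$ be the product of the distinct odd primes dividing $q^2-1$, let $r\mid q_2'$, and let $r_1,\dots,r_s$ be divisors of $r$ with $\gcd(r_i,r_j)=r_0$ for all $i\ne j$ and $\mathrm{lcm}(r_1,\dots,r_s)=r$. Then $$\mathcal{Q}_r\ \ge\ \sum_{i=1}^s\mathcal{Q}_{r_i}-(s-1)\mathcal{Q}_{r_0}.$$
   Context: $\mathrm{Tr}(x)=x+x^q$ for $x\in\mathbb{F}_{q^2}$. For $t\mid q^2-1$, $\xi\in\mathbb{F}_{q^2}^*$ is $t$-free if $\xi=\zeta^d$ with $d\mid t$, $\zeta\in\mathbb{F}_{q^2}^*$ implies $d=1$. For $t\mid q_2'$, $\mathcal{Q}_t$ is the number of $\alpha\in\mathbb{F}_q$ such that $\theta_1+\alpha\theta_2$ is $t$-free and is a square but not a fourth power in $\mathbb{F}_{q^2}^*$. -}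

module Defs where

open import Level using (Level; _⊔_) renaming (suc to lsuc)
open import Data.Nat using (ℕ; _∸_; _^_; _%_; _≟_)
import Data.Nat as ℕ
open import Data.Nat.Divisibility using (_∣_; _∣?_)
open import Data.Nat.Primality using (Prime; prime?)
open import Data.Nat.LCM using (lcm)
open import Data.List using (List; length; filter; upTo; foldr; map)
open import Data.List.Relation.Unary.Any using (Any)
open import Data.Fin using (Fin)
open import Data.List using (allFin)
open import Data.Product using (∃; _×_; Σ)
open import Relation.Nullary using (¬_; _×-dec_)
open import Relation.Binary.PropositionalEquality using (_≡_)
open import Relation.Binary using (Decidable)
open import Function.Bundles using (_⇔_)
open import Algebra.Bundles using (CommutativeRing)
import Algebra.Bundles
import Algebra.Definitions.RawSemiring as RS
import Data.List.Relation.Unary.Unique.Setoid as UniqueS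

OddPrimePower : ℕ → Set
OddPrimePower q = Σ ℕ λ p → Σ ℕ λ k → Prime p × (p % 2 ≡ 1) × (1 Data.Nat.≤ k) × (q ≡ p ^ k)

-- q₂' (n) : product of the distinct odd primes dividing n.
-- (For n ≥ 1 every prime divisor of n is < n + 1, so ranging over upTo (n+1) is exhaustive.)
oddRadical : ℕ → ℕ
oddRadical n =
  foldr ℕ._*_ 1 (filter (λ p → prime? p ×-dec ((p % 2) ≟ 1) ×-dec (p ∣? n)) (upTo (Data.Nat.suc n)))

q₂′ : ℕ → ℕ
q₂′ q = oddRadical (q ^ 2 ∸ 1)

lcmFam : (s : ℕ) → (Fin s → ℕ) → ℕ
lcmFam s r = foldr lcm 1 (map r (allFin s))

sumFam : (s : ℕ) → (Fin s → ℕ) → ℕ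
sumFam s f = foldr Data.Nat._+_ 0 (map f (allFin s))

record FiniteField (c ℓ : Level) (n : ℕ) : Set (lsuc (c ⊔ ℓ)) where
  field
    commRing : CommutativeRing c ℓ
  open CommutativeRing commRing public
  field
    _≈?_     : Decidable _≈_
    1≉0      : ¬ (1# ≈ 0#)
    inverse  : ∀ x → ¬ (x ≈ 0#) → ∃ λ y → (x * y) ≈ 1#
    elements : List Carrier
    complete : ∀ x → Any (x ≈_) elements
    unique   : UniqueS.Unique setoid elements
    card     : length elements ≡ n

module InField {c ℓ : Level} (q : ℕ) (F : FiniteField c ℓ (q ^ 2)) where
  open FiniteField F
  open RS (Algebra.Bundles.Semiring.rawSemiring semiring) using () renaming (_^_ to _^ᶠ_)

  Tr : Carrier → Carrier
  Tr x = x + (x ^ᶠ q)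

  InFq : Carrier → Set ℓ
  InFq x = (x ^ᶠ q) ≈ x

  IsFqBasis : Carrier → Carrier → Set (c ⊔ ℓ)
  IsFqBasis θ₁ θ₂ =
    (∀ x → Σ Carrier λ a → Σ Carrier λ b → InFq a × InFq b × (x ≈ ((a * θ₁) + (b * θ₂))))
    × (∀ a b → InFq a → InFq b → ((a * θ₁) + (b * θ₂)) ≈ 0# → (a ≈ 0#) × (b ≈ 0#))

  IsFree : ℕ → Carrier → Set (c ⊔ ℓ)
  IsFree t ξ = ∀ (d : ℕ) (ζ : Carrier) → d ∣ t → ¬ (ζ ≈ 0#) → ξ ≈ (ζ ^ᶠ d) → d ≡ 1

  IsSquare : Carrier → Set (c ⊔ ℓ)
  IsSquare ξ = Σ Carrier λ ζ → ¬ (ζ ≈ 0#) × (ξ ≈ (ζ ^ᶠ 2))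

  IsFourthPower : Carrier → Set (c ⊔ ℓ)
  IsFourthPower ξ = Σ Carrier λ ζ → ¬ (ζ ≈ 0#) × (ξ ≈ (ζ ^ᶠ 4))

  QPred : Carrier → Carrier → ℕ → Carrier → Set (c ⊔ ℓ)
  QPred θ₁ θ₂ t α =
    InFq α × (let ξ = θ₁ + (α * θ₂) in
              ¬ (ξ ≈ 0#) × IsFree t ξ × IsSquare ξ × ¬ IsFourthPower ξ)

  HasCount : ∀ {p} → (Carrier → Set p) → ℕ → Set (c ⊔ ℓ ⊔ p)
  HasCount P N = Σ (List Carrier) λ xs →
    UniqueS.Unique setoid xs × (∀ x → P x ⇔ Any (x ≈_) xs) × (length xs ≡ N)

-- Write 𝒜ₜ for the set of α counted by 𝒬_t. Freeness only shrinks
-- as t grows and, r being the lcm of the rᵢ, being r-free is the same as being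
-- rᵢ-free for every i (a nontrivial d ∣ r has a prime factor dividing some rᵢ).
-- Hence 𝒜_r = ⋂ᵢ 𝒜_{rᵢ}, and every 𝒜_{rᵢ} lies in 𝒜_{r₀} since r₀ ∣ rᵢ. Counting
-- over 𝒜_{r₀}, a point outside 𝒜_r misses some 𝒜_{rᵢ}, so it lies in at most s − 1
-- of them, which gives Σᵢ |𝒜_{rᵢ}| ≤ |𝒜_r| + (s − 1)|𝒜_{r₀}|. The argument uses
-- nothing about θ₁, θ₂, β or q beyond q₂′ ≠ 0.
{-# OPTIONS --safe #-}
module Submission where

open import Defs
open import Level using (Level)
open import Data.Nat using (ℕ; zero; suc; _+_; _*_; _^_; _%_; _≤_; _∸_; _≟_; z≤n; s≤s; ≢-nonZero⁻¹)
import Data.Nat.Properties as ℕ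
open import Data.Nat.Solver using (module +-*-Solver)
open import Data.Nat.Divisibility using (_∣_; _∣?_; divides; ∣-trans; 0∣⇒≡0; ∣1⇒≡1; m∣m*n)
open import Data.Nat.GCD using (gcd; gcd[m,n]∣m)
open import Data.Nat.LCM using (lcm; gcd*lcm)
open import Data.Nat.Primality using (Prime; prime?; euclidsLemma; ¬prime[1]; productOfPrimes≢0)
open import Data.Nat.Primality.Factorisation using (factorise)
open import Data.Integer using (+_; _⊖_) renaming (_-_ to _-ℤ_; _*_ to _*ℤ_; _≤_ to _≤ℤ_)
import Data.Integer.Properties as ℤ
open import Data.Fin using (Fin; zero; suc; punchIn)
open import Data.Fin.Properties using (¬∀⟶∃¬; punchInᵢ≢i)
open import Data.Vec.Functional using (Vector)
import Data.Vec.Functional as Vector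
open import Data.List using (List; []; _∷_; length; filter; upTo; tabulate)
import Data.List as List
open import Data.List.Relation.Unary.Any using (here; there)
open import Data.List.Relation.Unary.All using (_∷_)
import Data.List.Relation.Unary.All as All
open import Data.List.Relation.Unary.All.Properties using (all-filter)
open import Data.List.Relation.Unary.AllPairs using ([]; _∷_)
import Data.List.Fresh as Fresh
import Data.List.Fresh.Relation.Unary.Any as FreshAny
import Data.List.Fresh.Membership.Setoid.Properties as FreshMembership
import Data.List.Relation.Unary.Unique.Setoid as UniqueSetoid
import Data.List.Relation.Unary.Unique.Setoid.Properties as Unique
import Data.List.Membership.DecSetoid as DecMembership
import Data.List.Membership.Setoid.Properties as Membership
import Data.List.Relation.Binary.Subset.Setoid as Subset
open import Data.Product using (∃; _×_; _,_; proj₁; proj₂)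
open import Data.Sum using (inj₁; inj₂)
open import Function using (_∘_; id)
open import Function.Bundles using (Equivalence; _⇔_)
open import Relation.Nullary using (¬_; yes; no; contradiction; _×-dec_)
import Relation.Unary as Unary
open import Relation.Binary using (DecSetoid)
open import Relation.Binary.PropositionalEquality using (_≡_; _≢_; refl; cong; sym; trans; subst; subst₂; cong₂)
open import Algebra.Bundles using (Semiring)
import Algebra.Definitions.RawSemiring as RawSemiringDefs
import Algebra.Properties.CommutativeMonoid.Sum as CommutativeMonoidSum

open CommutativeMonoidSum ℕ.+-0-commutativeMonoid
  using (sum; sum-syntax; sum-remove; sum-replicate-zero; sum-cong-≗; ∑-distrib-+)

foldr-map-tabulate : ∀ {a b c n} {A : Set a} {B : Set b} {C : Set c}
                     (_∙_ : B → C → C) (e : C) (f : A → B) (g : Fin n → A) →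
                     List.foldr _∙_ e (List.map f (tabulate g)) ≡ Vector.foldr _∙_ e (f ∘ g)
foldr-map-tabulate {n = zero}  _∙_ e f g = refl
foldr-map-tabulate {n = suc n} _∙_ e f g = cong (f (g zero) ∙_) (foldr-map-tabulate _∙_ e f (g ∘ suc))

sum-≤-length : ∀ {n} (f : Vector ℕ n) → (∀ i → f i ≤ 1) → sum f ≤ n
sum-≤-length {zero}  f f≤1 = z≤n
sum-≤-length {suc n} f f≤1 = ℕ.+-mono-≤ (f≤1 zero) (sum-≤-length (f ∘ suc) (f≤1 ∘ suc))

sum-≤-pred-length : ∀ {n} (f : Vector ℕ (suc n)) (j : Fin (suc n)) →
                    (∀ i → f i ≤ 1) → f j ≡ 0 → sum f ≤ n
sum-≤-pred-length f j f≤1 fj≡0 rewrite sum-remove {i = j} f | fj≡0 =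
  sum-≤-length _ (λ i → f≤1 _)

module Counting {c ℓ} (S : DecSetoid c ℓ) where
  open DecSetoid S using (setoid; _≈_) renaming (Carrier to A)
  open DecMembership S using (_∈_; _∉_; _∈?_)
  open UniqueSetoid setoid using (Unique)
  open Subset setoid using (_⊆_)

  private
    fresh : ∀ {xs} → Unique xs → Fresh.List# A (λ x y → ¬ x ≈ y)
    fresh = Fresh.fromList

    length-fresh : ∀ {xs} (u : Unique xs) → Fresh.length (fresh u) ≡ length xs
    length-fresh []      = refl
    length-fresh (_ ∷ u) = cong suc (length-fresh u)

    ∈-fresh⁺ : ∀ {x xs} (u : Unique xs) → x ∈ xs → FreshAny.Any (DecSetoid._≈_ S x) (fresh u)
    ∈-fresh⁺ (_ ∷ u) (here x≈y)  = FreshAny.here x≈y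
    ∈-fresh⁺ (_ ∷ u) (there x∈) = FreshAny.there (∈-fresh⁺ u x∈)

    ∈-fresh⁻ : ∀ {x xs} (u : Unique xs) → FreshAny.Any (DecSetoid._≈_ S x) (fresh u) → x ∈ xs
    ∈-fresh⁻ (_ ∷ u) (FreshAny.here x≈y)  = here x≈y
    ∈-fresh⁻ (_ ∷ u) (FreshAny.there x∈) = there (∈-fresh⁻ u x∈)

  length-mono-⊆ : ∀ {xs ys} → Unique xs → Unique ys → xs ⊆ ys → length xs ≤ length ys
  length-mono-⊆ uxs uys xs⊆ys =
    subst₂ _≤_ (length-fresh uxs) (length-fresh uys)
      (FreshMembership.injection setoid id (∈-fresh⁺ uys ∘ xs⊆ys ∘ ∈-fresh⁻ uxs))

  𝟙[_∈_] : A → List A → ℕ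
  𝟙[ u ∈ xs ] with u ∈? xs
  ... | yes _ = 1
  ... | no  _ = 0

  𝟙[∈]≤1 : ∀ u xs → 𝟙[ u ∈ xs ] ≤ 1
  𝟙[∈]≤1 u xs with u ∈? xs
  ... | yes _ = s≤s z≤n
  ... | no  _ = z≤n

  ∉⇒𝟙[∈]≡0 : ∀ {u xs} → u ∉ xs → 𝟙[ u ∈ xs ] ≡ 0
  ∉⇒𝟙[∈]≡0 {u} {xs} u∉xs with u ∈? xs
  ... | yes u∈xs = contradiction u∈xs u∉xs
  ... | no  _    = refl

  countIn : List A → List A → ℕ
  countIn xs []      = 0
  countIn xs (u ∷ B) = 𝟙[ u ∈ xs ] + countIn xs B

  countIn≡length-filter : ∀ xs B → countIn xs B ≡ length (filter (_∈? xs) B)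
  countIn≡length-filter xs []      = refl
  countIn≡length-filter xs (u ∷ B) with u ∈? xs
  ... | yes _ = cong suc (countIn≡length-filter xs B)
  ... | no  _ = countIn≡length-filter xs B

  length≡countIn : ∀ {xs B} → Unique xs → Unique B → xs ⊆ B → length xs ≡ countIn xs B
  length≡countIn {xs} {B} uxs uB xs⊆B = trans
    (ℕ.≤-antisym (length-mono-⊆ uxs uB∩xs (λ x∈xs → Membership.∈-filter⁺ setoid (_∈? xs) ∈-resp (xs⊆B x∈xs) x∈xs))
                 (length-mono-⊆ uB∩xs uxs (proj₂ ∘ Membership.∈-filter⁻ setoid (_∈? xs) ∈-resp {xs = B})))
    (sym (countIn≡length-filter xs B))
    where
    uB∩xs : Unique (filter (_∈? xs) B)
    uB∩xs = Unique.filter⁺ setoid (_∈? xs) uB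
    ∈-resp : ∀ {x y} → x ≈ y → x ∈ xs → y ∈ xs
    ∈-resp = Membership.∈-resp-≈ setoid

  module _ {n} (Ls : Fin (suc n) → List A) (L : List A) (⋂Ls⊆L : ∀ {x} → (∀ i → x ∈ Ls i) → x ∈ L) where

    ∑𝟙[∈]≤𝟙[∈⋂]+n : ∀ u → ∑[ i < suc n ] 𝟙[ u ∈ Ls i ] ≤ 𝟙[ u ∈ L ] + n
    ∑𝟙[∈]≤𝟙[∈⋂]+n u with u ∈? L
    ... | yes _   = sum-≤-length _ (λ i → 𝟙[∈]≤1 u (Ls i))
    ... | no  u∉L with ¬∀⟶∃¬ (suc n) (λ i → u ∈ Ls i) (λ i → u ∈? Ls i) (u∉L ∘ ⋂Ls⊆L)
    ...   | j , u∉Lⱼ = sum-≤-pred-length _ j (λ i → 𝟙[∈]≤1 u (Ls i)) (∉⇒𝟙[∈]≡0 u∉Lⱼ)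

    ∑countIn≤countIn+n*length : ∀ B → ∑[ i < suc n ] countIn (Ls i) B ≤ countIn L B + n * length B
    ∑countIn≤countIn+n*length []      = ℕ.≤-reflexive (trans (sum-replicate-zero (suc n)) (sym (ℕ.*-zeroʳ n)))
    ∑countIn≤countIn+n*length (u ∷ B) = begin
      ∑[ i < suc n ] (𝟙[ u ∈ Ls i ] + countIn (Ls i) B)
        ≡⟨ ∑-distrib-+ (λ i → 𝟙[ u ∈ Ls i ]) (λ i → countIn (Ls i) B) ⟩
      ∑[ i < suc n ] 𝟙[ u ∈ Ls i ] + ∑[ i < suc n ] countIn (Ls i) B
        ≤⟨ ℕ.+-mono-≤ (∑𝟙[∈]≤𝟙[∈⋂]+n u) (∑countIn≤countIn+n*length B) ⟩
      (𝟙[ u ∈ L ] + n) + (countIn L B + n * length B)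
        ≡⟨ solve 4 (λ a b k m → (a :+ k) :+ (b :+ k :* m) := (a :+ b) :+ k :* (con 1 :+ m)) refl
             𝟙[ u ∈ L ] (countIn L B) n (length B) ⟩
      (𝟙[ u ∈ L ] + countIn L B) + n * suc (length B) ∎
      where
      open ℕ.≤-Reasoning
      open +-*-Solver using (solve; _:+_; _:*_; _:=_; con)

    ∑length≤length⋂+n*length : ∀ {B} → (∀ i → Unique (Ls i)) → Unique L → Unique B →
                                L ⊆ B → (∀ i → Ls i ⊆ B) →
                                ∑[ i < suc n ] length (Ls i) ≤ length L + n * length B
    ∑length≤length⋂+n*length {B} uLs uL uB L⊆B Ls⊆B = begin
      ∑[ i < suc n ] length (Ls i)        ≡⟨ sum-cong-≗ (λ i → length≡countIn (uLs i) uB (Ls⊆B i)) ⟩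
      ∑[ i < suc n ] countIn (Ls i) B     ≤⟨ ∑countIn≤countIn+n*length B ⟩
      countIn L B + n * length B          ≡⟨ cong (_+ n * length B) (length≡countIn uL uB L⊆B) ⟨
      length L + n * length B             ∎
      where open ℕ.≤-Reasoning

lcm∣* : ∀ m n → lcm m n ∣ m * n
lcm∣* m n = divides (gcd m n) (sym (gcd*lcm m n))

prime∣foldr-lcm⇒∣ : ∀ {n p} (rs : Vector ℕ n) → Prime p → p ∣ Vector.foldr lcm 1 rs → ∃ λ i → p ∣ rs i
prime∣foldr-lcm⇒∣ {zero}  rs p-prime p∣1 = contradiction (subst Prime (∣1⇒≡1 p∣1) p-prime) ¬prime[1]
prime∣foldr-lcm⇒∣ {suc n} rs p-prime p∣lcm
  with euclidsLemma (rs zero) _ p-prime (∣-trans p∣lcm (lcm∣* (rs zero) _))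
... | inj₁ p∣r₀ = zero , p∣r₀
... | inj₂ p∣rest with prime∣foldr-lcm⇒∣ (rs ∘ suc) p-prime p∣rest
...   | i , p∣rᵢ = suc i , p∣rᵢ

∃-prime-divisor : ∀ {n} → n ≢ 0 → n ≢ 1 → ∃ λ p → Prime p × p ∣ n
∃-prime-divisor {zero}  n≢0 n≢1 = contradiction refl n≢0
∃-prime-divisor {suc n} n≢0 n≢1 with factorise (suc n)
... | record { factors = []     ; isFactorisation = n≡1 } = contradiction n≡1 n≢1
... | record { factors = p ∷ ps ; isFactorisation = n≡p*m ; factorsPrime = p-prime ∷ _ } =
  p , p-prime , subst (p ∣_) (sym n≡p*m) (m∣m*n _)

oddRadical≢0 : ∀ n → oddRadical n ≢ 0
oddRadical≢0 n = ≢-nonZero⁻¹ _ {{productOfPrimes≢0 (All.map proj₁ (all-filter oddPrimeDivisor? (upTo (suc n))))}}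
  where
  oddPrimeDivisor? : Unary.Decidable (λ p → Prime p × p % 2 ≡ 1 × p ∣ n)
  oddPrimeDivisor? p = prime? p ×-dec (p % 2 ≟ 1) ×-dec (p ∣? n)

+m-+n*+k≤+o : ∀ {m o} n k → m ≤ o + n * k → + m -ℤ (+ n *ℤ + k) ≤ℤ + o
+m-+n*+k≤+o {m} {o} n k m≤o+nk = begin
  + m -ℤ (+ n *ℤ + k)  ≡⟨ cong (λ z → + m -ℤ z) (ℤ.pos-* n k) ⟨
  + m -ℤ + (n * k)     ≡⟨ ℤ.m-n≡m⊖n m (n * k) ⟩
  m ⊖ (n * k)          ≤⟨ ℤ.⊖-monoˡ-≤ (n * k) m≤o+nk ⟩
  (o + n * k) ⊖ n * k  ≡⟨ ℤ.⊖-≥ (ℕ.m≤n+m (n * k) o) ⟩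
  + (o + n * k ∸ n * k) ≡⟨ cong +_ (ℕ.m+n∸n≡m o (n * k)) ⟩
  + o                  ∎
  where open ℤ.≤-Reasoning

module FieldLemmas {c ℓ} (q : ℕ) (F : FiniteField c ℓ (q ^ 2)) where
  open FiniteField F
    using (Carrier; _≈_; 0#; 1#; 1≉0; inverse; setoid; isEquivalence; _≈?_; semiring;
           *-identityˡ; *-congʳ; *-congˡ; *-comm; *-assoc; zeroʳ)
    renaming (_*_ to _·_)
  open InField q F
  open RawSemiringDefs (Semiring.rawSemiring semiring) using () renaming (_^_ to _^ᶠ_)
  open import Algebra.Properties.Semiring.Exp semiring using (^-assocʳ)
  open import Relation.Binary.Reasoning.Setoid setoid

  *-nonzero : ∀ {x y} → ¬ x ≈ 0# → ¬ y ≈ 0# → ¬ x · y ≈ 0#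
  *-nonzero {x} {y} x≉0 y≉0 xy≈0 with inverse x x≉0
  ... | x⁻¹ , xx⁻¹≈1 = y≉0 (begin
    y              ≈⟨ *-identityˡ y ⟨
    1# · y         ≈⟨ *-congʳ xx⁻¹≈1 ⟨
    (x · x⁻¹) · y  ≈⟨ *-congʳ (*-comm x x⁻¹) ⟩
    (x⁻¹ · x) · y  ≈⟨ *-assoc x⁻¹ x y ⟩
    x⁻¹ · (x · y)  ≈⟨ *-congˡ xy≈0 ⟩
    x⁻¹ · 0#       ≈⟨ zeroʳ x⁻¹ ⟩
    0#             ∎)

  ^-nonzero : ∀ {x} → ¬ x ≈ 0# → ∀ k → ¬ (x ^ᶠ k) ≈ 0#
  ^-nonzero x≉0 zero    = 1≉0
  ^-nonzero x≉0 (suc k) = *-nonzero x≉0 (^-nonzero x≉0 k)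

  IsFree-∣ : ∀ {t t′ ξ} → t ∣ t′ → IsFree t′ ξ → IsFree t ξ
  IsFree-∣ t∣t′ ξ-free d ζ d∣t = ξ-free d ζ (∣-trans d∣t t∣t′)

  IsFree-lcm : ∀ {n ξ} (rs : Vector ℕ n) → Vector.foldr lcm 1 rs ≢ 0 →
               (∀ i → IsFree (rs i) ξ) → IsFree (Vector.foldr lcm 1 rs) ξ
  IsFree-lcm {ξ = ξ} rs lcm≢0 ξ-free d ζ d∣lcm ζ≉0 ξ≈ζ^d with d ≟ 1
  ... | yes d≡1 = d≡1
  ... | no  d≢1 with ∃-prime-divisor (λ d≡0 → lcm≢0 (0∣⇒≡0 (subst (_∣ _) d≡0 d∣lcm))) d≢1
  ...   | p , p-prime , divides k d≡k*p
          with prime∣foldr-lcm⇒∣ rs p-prime (∣-trans (divides k d≡k*p) d∣lcm)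
  ...     | i , p∣rᵢ = contradiction (subst Prime p≡1 p-prime) ¬prime[1]
    where
    ξ≈[ζ^k]^p : ξ ≈ (ζ ^ᶠ k) ^ᶠ p
    ξ≈[ζ^k]^p = begin
      ξ              ≈⟨ ξ≈ζ^d ⟩
      ζ ^ᶠ d         ≡⟨ cong (ζ ^ᶠ_) d≡k*p ⟩
      ζ ^ᶠ (k * p)   ≈⟨ ^-assocʳ ζ k p ⟨
      (ζ ^ᶠ k) ^ᶠ p  ∎
    p≡1 : p ≡ 1
    p≡1 = ξ-free i p (ζ ^ᶠ k) p∣rᵢ (^-nonzero ζ≉0 k) ξ≈[ζ^k]^p

  QPred-∣ : ∀ {θ₁ θ₂ t t′ α} → t ∣ t′ → QPred θ₁ θ₂ t′ α → QPred θ₁ θ₂ t α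
  QPred-∣ t∣t′ (α∈Fq , ξ≉0 , ξ-free , ξ-square , ξ-notFourth) =
    α∈Fq , ξ≉0 , IsFree-∣ t∣t′ ξ-free , ξ-square , ξ-notFourth

  QPred-lcm : ∀ {θ₁ θ₂ n α} (rs : Vector ℕ (suc n)) → Vector.foldr lcm 1 rs ≢ 0 →
              (∀ i → QPred θ₁ θ₂ (rs i) α) → QPred θ₁ θ₂ (Vector.foldr lcm 1 rs) α
  QPred-lcm rs lcm≢0 Qrs with Qrs zero
  ... | α∈Fq , ξ≉0 , _ , ξ-square , ξ-notFourth =
    α∈Fq , ξ≉0 , IsFree-lcm rs lcm≢0 (proj₁ ∘ proj₂ ∘ proj₂ ∘ Qrs) , ξ-square , ξ-notFourth

  decSetoid : DecSetoid c ℓ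
  decSetoid = record { isDecEquivalence = record { isEquivalence = isEquivalence ; _≟_ = _≈?_ } }

  HasCount-∑≤ : ∀ {p n} {P P₀ : Carrier → Set p} {Ps : Fin (suc n) → Carrier → Set p}
                {N N₀ : ℕ} {Ns : Vector ℕ (suc n)} →
                HasCount P N → (∀ i → HasCount (Ps i) (Ns i)) → HasCount P₀ N₀ →
                (∀ x → (∀ i → Ps i x) → P x) → (∀ x → P x → P₀ x) → (∀ i x → Ps i x → P₀ x) →
                ∑[ i < suc n ] Ns i ≤ N + n * N₀
  HasCount-∑≤ {n = n} {Ps = Ps} {N} {N₀} {Ns} (L , uL , L⇔ , |L|≡N) countPs (B , uB , B⇔ , |B|≡N₀)
              ⋂Ps⊆P P⊆P₀ Ps⊆P₀ =
    subst₂ _≤_ (sum-cong-≗ |Ls|≡Ns) (cong₂ (λ a b → a + n * b) |L|≡N |B|≡N₀)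
      (∑length≤length⋂+n*length Ls L ⋂Ls⊆L uLs uL uB
        (λ {x} → to (B⇔ x) ∘ P⊆P₀ x ∘ from (L⇔ x))
        (λ i {x} → to (B⇔ x) ∘ Ps⊆P₀ i x ∘ from (Ls⇔ i x)))
    where
    open Counting decSetoid
    open DecMembership decSetoid using (_∈_)
    open UniqueSetoid setoid using (Unique)
    open Equivalence
    Ls : Fin (suc n) → List Carrier
    Ls i = proj₁ (countPs i)
    uLs : ∀ i → Unique (Ls i)
    uLs i = proj₁ (proj₂ (countPs i))
    Ls⇔ : ∀ i x → Ps i x ⇔ x ∈ Ls i
    Ls⇔ i = proj₁ (proj₂ (proj₂ (countPs i)))
    |Ls|≡Ns : ∀ i → length (Ls i) ≡ Ns i
    |Ls|≡Ns i = proj₂ (proj₂ (proj₂ (countPs i)))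
    ⋂Ls⊆L : ∀ {x} → (∀ i → x ∈ Ls i) → x ∈ L
    ⋂Ls⊆L {x} x∈Ls = to (L⇔ x) (⋂Ps⊆P x (λ i → from (Ls⇔ i x) (x∈Ls i)))

module QBounds {c ℓ} (q : ℕ) (F : FiniteField c ℓ (q ^ 2)) (θ₁ θ₂ : FiniteField.Carrier F) (Q : ℕ → ℕ)
               (count : ∀ t → t ∣ q₂′ q → InField.HasCount q F (InField.QPred q F θ₁ θ₂ t) (Q t)) where
  open InField q F using (QPred; HasCount)
  open FieldLemmas q F

  count-∣ : ∀ {t t′} → t ∣ t′ → t′ ∣ q₂′ q → HasCount (QPred θ₁ θ₂ t) (Q t)
  count-∣ t∣t′ t′∣q₂′ = count _ (∣-trans t∣t′ t′∣q₂′)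

  ⋂QPred⇒QPred-lcm : ∀ {n r} (rs : Vector ℕ (suc n)) → r ∣ q₂′ q → Vector.foldr lcm 1 rs ≡ r →
                     ∀ x → (∀ i → QPred θ₁ θ₂ (rs i) x) → QPred θ₁ θ₂ r x
  ⋂QPred⇒QPred-lcm rs r∣q₂′ refl x = QPred-lcm rs lcm≢0
    where
    lcm≢0 : Vector.foldr lcm 1 rs ≢ 0
    lcm≢0 lcm≡0 = oddRadical≢0 (q ^ 2 ∸ 1) (0∣⇒≡0 (subst (_∣ q₂′ q) lcm≡0 r∣q₂′))

  -- With a single rᵢ nothing relates r₀ to the rᵢ (it need not even divide q₂′);
  -- 𝒬_{r₁} takes its place, the multiplier n being 0.
  ∑Q≤Q+n*Q : ∀ {n r r₀} (rs : Vector ℕ (suc n)) → r ∣ q₂′ q → (∀ i → rs i ∣ r) →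
             (∀ i j → i ≢ j → gcd (rs i) (rs j) ≡ r₀) → Vector.foldr lcm 1 rs ≡ r →
             ∑[ i < suc n ] Q (rs i) ≤ Q r + n * Q r₀
  ∑Q≤Q+n*Q {zero} rs r∣q₂′ rs∣r _ lcm≡r =
    HasCount-∑≤ (count _ r∣q₂′) (λ i → count-∣ (rs∣r i) r∣q₂′) (count-∣ (rs∣r zero) r∣q₂′)
      (⋂QPred⇒QPred-lcm rs r∣q₂′ lcm≡r) (λ _ → QPred-∣ (rs∣r zero)) (λ { zero _ → id })
  ∑Q≤Q+n*Q {suc n} {r} {r₀} rs r∣q₂′ rs∣r gcd≡r₀ lcm≡r =
    HasCount-∑≤ (count _ r∣q₂′) (λ i → count-∣ (rs∣r i) r∣q₂′) (count-∣ r₀∣r r∣q₂′)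
      (⋂QPred⇒QPred-lcm rs r∣q₂′ lcm≡r) (λ _ → QPred-∣ r₀∣r) (λ i _ → QPred-∣ (r₀∣rs i))
    where
    r₀∣rs : ∀ i → r₀ ∣ rs i
    r₀∣rs i = subst (_∣ rs i) (gcd≡r₀ i (punchIn i zero) (punchInᵢ≢i i zero ∘ sym)) (gcd[m,n]∣m (rs i) _)
    r₀∣r : r₀ ∣ r
    r₀∣r = ∣-trans (r₀∣rs zero) (rs∣r zero)

proposition6p6 : ∀ {c ℓ : Level} (q : ℕ) → OddPrimePower q →
    (F : FiniteField c ℓ (q ^ 2)) →
    let open FiniteField F
        open InField q F
    in (β θ₁ θ₂ : Carrier) →
       InFq β → ¬ (β ≈ 0#) →
       IsFqBasis θ₁ θ₂ → Tr θ₁ ≈ β → Tr θ₂ ≈ 0# →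
       (Q : ℕ → ℕ) →
       (∀ t → t ∣ q₂′ q → HasCount (QPred θ₁ θ₂ t) (Q t)) →
       (r : ℕ) → r ∣ q₂′ q →
       (s : ℕ) → 1 ≤ s → (rs : Fin s → ℕ) → (r₀ : ℕ) →
       (∀ i → rs i ∣ r) →
       (∀ i j → i ≢ j → gcd (rs i) (rs j) ≡ r₀) →
       lcmFam s rs ≡ r →
       ((+ sumFam s (λ i → Q (rs i))) -ℤ ((+ (s ∸ 1)) *ℤ (+ Q r₀))) ≤ℤ (+ Q r)
proposition6p6 q _ F _ θ₁ θ₂ _ _ _ _ _ Q count r r∣q₂′ (suc n) (s≤s z≤n) rs r₀ rs∣r gcd≡r₀ lcmFam≡r =
  +m-+n*+k≤+o n (Q r₀) (subst (_≤ Q r + n * Q r₀) (sym sumFam≡∑) (∑Q≤Q+n*Q rs r∣q₂′ rs∣r gcd≡r₀ lcm≡r))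
  where
  open QBounds q F θ₁ θ₂ Q count
  sumFam≡∑ : sumFam (suc n) (Q ∘ rs) ≡ ∑[ i < suc n ] Q (rs i)
  sumFam≡∑ = foldr-map-tabulate _+_ 0 (Q ∘ rs) id
  lcm≡r : Vector.foldr lcm 1 rs ≡ r
  lcm≡r = trans (sym (foldr-map-tabulate lcm 1 rs id)) lcmFam≡r
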